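{- Let $n\geq 3$ be an integer (even or odd), $k\geq 3$ and $m\geq 2$ integers. Then the minimum size of a strong resolving set of vertices of $(C_n\Box P_k)\Box P_m$ is $2n$, i.e. $sdim((C_n\Box P_k)\Box P_m)=2n$.
   Context: $C_n$ denotes the cycle on $n$ vertices and $P_k$, $P_m$ the paths on $k$ and $m$ vertices. For graphs $G,H$, the Cartesian product $G\Box H$ has vertex set $V(G)\times V(H)$, with $(g_1,h_1)$ adjacent to $(g_2,h_2)$ iff either $h_1=h_2$ and $g_1g_2\in E(G)$, or $g_1=g_2$ and $h_1h_2\in E(H)$. In a connected graph $G$, a set $Q\subseteq V(G)$ is a strong resolving set if for any two distinct vertices $p,q$ there is $r\in Q$ such that $p$ lies on a shortest $q$–$r$ path or $q$ lies on a shortest $p$–$r$ path. $sdim(G)$ is the minimum size of a strong resolving set of $G$. -}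

module Defs where

open import Data.Nat using (ℕ; zero; suc; _+_; _≤_)
open import Data.Fin using (Fin; toℕ)
open import Data.Product using (_×_; _,_; Σ)
open import Relation.Nullary using (¬_)
open import Data.Sum using (_⊎_)
open import Data.List using (List; length)
open import Data.List.Membership.Propositional using (_∈_)
open import Data.List.Relation.Unary.Unique.Propositional using (Unique)
open import Relation.Binary.PropositionalEquality using (_≡_)

record Graph : Set₁ where
  field
    V   : Set
    Adj : V → V → Set
open Graph public

PathG : ℕ → Graph
PathG k = record
  { V = Fin k
  ; Adj = λ i j → (toℕ j ≡ suc (toℕ i)) ⊎ (toℕ i ≡ suc (toℕ j)) }

Cycle : ℕ → Graph
Cycle n = record
  { V = Fin n
  ; Adj = λ i j → (toℕ j ≡ suc (toℕ i)) ⊎ (toℕ i ≡ suc (toℕ j))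
                  ⊎ ((toℕ i ≡ 0) × (suc (toℕ j) ≡ n))
                  ⊎ ((toℕ j ≡ 0) × (suc (toℕ i) ≡ n)) }

_□_ : Graph → Graph → Graph
G □ H = record
  { V = V G × V H
  ; Adj = λ { (g₁ , h₁) (g₂ , h₂) →
              ((h₁ ≡ h₂) × Adj G g₁ g₂) ⊎ ((g₁ ≡ g₂) × Adj H h₁ h₂) } }

data Walk (G : Graph) : V G → V G → ℕ → Set where
  []  : ∀ {u} → Walk G u u zero
  _∷_ : ∀ {u w v ℓ} → Adj G u w → Walk G w v ℓ → Walk G u v (suc ℓ)

data OnWalk (G : Graph) (x : V G) : ∀ {u v ℓ} → Walk G u v ℓ → Set where
  here-end : OnWalk G x ([] {u = x})
  here     : ∀ {w v ℓ} (e : Adj G x w) (p : Walk G w v ℓ) → OnWalk G x (e ∷ p)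
  there    : ∀ {u w v ℓ} (e : Adj G u w) {p : Walk G w v ℓ} →
             OnWalk G x p → OnWalk G x (e ∷ p)

-- A shortest u–v path: a walk of minimum length among all u–v walks
-- (a shortest walk is necessarily a path).
IsShortest : (G : Graph) {u v : V G} {ℓ : ℕ} → Walk G u v ℓ → Set
IsShortest G {u} {v} {ℓ} _ = ∀ ℓ' → Walk G u v ℓ' → ℓ ≤ ℓ'

OnShortest : (G : Graph) → V G → V G → V G → Set
OnShortest G x u v =
  Σ ℕ (λ ℓ → Σ (Walk G u v ℓ) (λ p → IsShortest G p × OnWalk G x p))

StrongResolving : (G : Graph) → List (V G) → Set
StrongResolving G Q =
  ∀ (p q : V G) → ¬ (p ≡ q) →
    Σ (V G) (λ r → (r ∈ Q) × (OnShortest G p q r ⊎ OnShortest G q p r))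

SdimIs : Graph → ℕ → Set
SdimIs G d =
  Σ (List (V G)) (λ Q → Unique Q × StrongResolving G Q × (length Q ≡ d))
  × (∀ (Q : List (V G)) → Unique Q → StrongResolving G Q → d ≤ length Q)

-- In a Cartesian product, distances add up coordinatewise.
-- Upper bound: the 2n vertices (a, 0, 0) and (a, 0, m−1) form a strong
-- resolving set. For p, q with p no farther than q along P_k, take r with p's
-- cycle vertex, 0 on P_k, and the end of P_m beyond p as seen from q; then p
-- lies between q and r in every coordinate, hence on a shortest q–r path.
-- Lower bound: if u and v are mutually farthest, u lies on a shortest v–r path
-- only for r = u, so every strong resolving set contains u or v. Each of the
-- 2n vertices above is mutually farthest from (a + ⌊n/2⌋ mod n, k−1, other
-- end), and these 2n pairs are disjoint.
module Submission where

open import Defs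
open import Data.Bool using (Bool; true; false)
open import Data.Empty using (⊥-elim)
open import Data.Fin using (Fin; zero; suc; toℕ; fromℕ; fromℕ<; opposite; remQuot; combine)
open import Data.Fin.Properties
  using (toℕ-injective; toℕ<n; toℕ-fromℕ; toℕ-fromℕ<; ≤fromℕ; opposite-involutive;
         remQuot-combine; combine-remQuot; injective⇒≤)
open import Data.List using (List; length; map; allFin; lookup)
open import Data.List.Properties using (length-map; length-tabulate)
open import Data.List.Membership.Propositional using (_∈_)
open import Data.List.Membership.Propositional.Properties using (∈-map⁺; ∈-allFin)
open import Data.List.Relation.Unary.Any using (index)
open import Data.List.Relation.Unary.Any.Properties using (lookup-index)
open import Data.List.Relation.Unary.Unique.Propositional using (Unique)
open import Data.List.Relation.Unary.Unique.Propositional.Properties using (map⁺; allFin⁺)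
open import Data.Nat
open import Data.Nat.Properties
open import Algebra.Properties.CommutativeSemigroup +-commutativeSemigroup using (interchange)
open import Data.Product using (∃; _×_; _,_; proj₁; proj₂; uncurry; swap)
open import Data.Sum using (_⊎_; inj₁; inj₂)
open import Function using (_∘_; id)
open import Function.Definitions using (Injective)
open import Relation.Binary.Definitions using (Symmetric)
open import Relation.Binary.PropositionalEquality
open import Relation.Nullary using (¬_; yes; no)

private
  variable
    G H : Graph

infixr 5 _++ʷ_

_++ʷ_ : ∀ {u w v ℓ ℓ'} → Walk G u w ℓ → Walk G w v ℓ' → Walk G u v (ℓ + ℓ')
[]      ++ʷ q = q
(e ∷ p) ++ʷ q = e ∷ (p ++ʷ q)

mapʷ : (f : V G → V H) → (∀ {x y} → Adj G x y → Adj H (f x) (f y)) →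
       ∀ {u v ℓ} → Walk G u v ℓ → Walk H (f u) (f v) ℓ
mapʷ f f-adj []      = []
mapʷ f f-adj (e ∷ p) = f-adj e ∷ mapʷ f f-adj p

castʷ : ∀ {u v ℓ ℓ'} → ℓ ≡ ℓ' → Walk G u v ℓ → Walk G u v ℓ'
castʷ refl p = p

reverseʷ : Symmetric (Adj G) → ∀ {u v ℓ} → Walk G u v ℓ → Walk G v u ℓ
reverseʷ adj-sym []          = []
reverseʷ adj-sym (_∷_ {ℓ = ℓ} e p) =
  castʷ (+-comm ℓ 1) (reverseʷ adj-sym p ++ʷ adj-sym e ∷ [])

start-OnWalk : ∀ {u v ℓ} (p : Walk G u v ℓ) → OnWalk G u p
start-OnWalk []      = here-end
start-OnWalk (e ∷ p) = here e p

junction-OnWalk : ∀ {u w v ℓ ℓ'} (p : Walk G u w ℓ) (q : Walk G w v ℓ') →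
                  OnWalk G w (p ++ʷ q)
junction-OnWalk []      q = start-OnWalk q
junction-OnWalk (e ∷ p) q = there e (junction-OnWalk p q)

OnWalk⇒split : ∀ {x u v ℓ} {p : Walk G u v ℓ} → OnWalk G x p →
               ∃ λ ℓ₁ → ∃ λ ℓ₂ → Walk G u x ℓ₁ × Walk G x v ℓ₂ × ℓ₁ + ℓ₂ ≡ ℓ
OnWalk⇒split here-end   = 0 , 0 , [] , [] , refl
OnWalk⇒split (here e p) = 0 , _ , [] , e ∷ p , refl
OnWalk⇒split (there e x∈p) with OnWalk⇒split x∈p
... | ℓ₁ , ℓ₂ , p₁ , p₂ , eq = suc ℓ₁ , ℓ₂ , e ∷ p₁ , p₂ , cong suc eq

-- Shortest-path distances

-- dist-adj bounds dist by the length of every walk and geodesic attains it,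
-- so dist is the shortest-walk distance.
record GraphDistance (G : Graph) : Set where
  field
    dist     : V G → V G → ℕ
    dist-adj : ∀ {u w} v → Adj G u w → dist u v ≤ suc (dist w v)
    geodesic : ∀ u v → Walk G u v (dist u v)
    dist≡0⇒≡ : ∀ {u v} → dist u v ≡ 0 → u ≡ v
    dist-refl : ∀ u → dist u u ≡ 0

module _ (D : GraphDistance G) where
  open GraphDistance D

  dist≤length : ∀ {u v ℓ} → Walk G u v ℓ → dist u v ≤ ℓ
  dist≤length {u} []          = ≤-reflexive (dist-refl u)
  dist≤length {v = v} (e ∷ p) = ≤-trans (dist-adj v e) (s≤s (dist≤length p))

  data Farthest (x y : V G) : Set where
    farthest : (∀ r → dist x r ≤ dist x y) → Farthest x y

  MutuallyFarthest : V G → V G → Set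
  MutuallyFarthest x y = Farthest x y × Farthest y x

  data Between (q p r : V G) : Set where
    between : dist q p + dist p r ≡ dist q r → Between q p r

  between-refl : ∀ q p → Between q p p
  between-refl q p = between (trans (cong (dist q p +_) (dist-refl p)) (+-identityʳ _))

  Between⇒OnShortest : ∀ {q p r} → Between q p r → OnShortest G p q r
  Between⇒OnShortest {q} {p} {r} (between q-p-r) =
    _ , geodesic q p ++ʷ geodesic p r ,
    (λ ℓ w → subst (_≤ ℓ) (sym q-p-r) (dist≤length w)) ,
    junction-OnWalk (geodesic q p) (geodesic p r)

  Farthest⇒OnShortest⇒≡ : ∀ {u v r} → Farthest v u → OnShortest G u v r → u ≡ r
  Farthest⇒OnShortest⇒≡ {u} {v} {r} (farthest u-farthest) (ℓ , p , p-shortest , u∈p)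
    with OnWalk⇒split u∈p
  ... | ℓ₁ , ℓ₂ , p₁ , p₂ , ℓ₁+ℓ₂≡ℓ =
    dist≡0⇒≡ (n≤0⇒n≡0 (+-cancelˡ-≤ (dist v u) _ _ (begin
      dist v u + dist u r ≤⟨ +-mono-≤ (dist≤length p₁) (dist≤length p₂) ⟩
      ℓ₁ + ℓ₂             ≡⟨ ℓ₁+ℓ₂≡ℓ ⟩
      ℓ                   ≤⟨ p-shortest _ (geodesic v r) ⟩
      dist v r            ≤⟨ u-farthest r ⟩
      dist v u            ≡⟨ +-identityʳ _ ⟨
      dist v u + 0        ∎)))
    where open ≤-Reasoning

  mutuallyFarthest-∈ : ∀ {x y Q} → MutuallyFarthest x y → ¬ x ≡ y →
                       StrongResolving G Q → x ∈ Q ⊎ y ∈ Q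
  mutuallyFarthest-∈ {x} {y} (y-far , x-far) x≢y resolving
    with resolving x y x≢y
  ... | r , r∈Q , inj₁ x-on = inj₁ (subst (_∈ _) (sym (Farthest⇒OnShortest⇒≡ x-far x-on)) r∈Q)
  ... | r , r∈Q , inj₂ y-on = inj₂ (subst (_∈ _) (sym (Farthest⇒OnShortest⇒≡ y-far y-on)) r∈Q)

  -- Each of the t disjoint pairs contributes its own vertex of Q.
  mutuallyFarthestPairs⇒≤length :
    ∀ {t Q} (e : Fin t × Bool → V G) → Injective _≡_ _≡_ e →
    (∀ i → MutuallyFarthest (e (i , false)) (e (i , true))) →
    StrongResolving G Q → t ≤ length Q
  mutuallyFarthestPairs⇒≤length {t} {Q} e e-inj far resolving =
    injective⇒≤ {f = position} position-injective
    where
      sides-distinct : ∀ i → ¬ e (i , false) ≡ e (i , true)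
      sides-distinct i eq with e-inj eq
      ... | ()

      member : ∀ i → ∃ λ b → e (i , b) ∈ Q
      member i with mutuallyFarthest-∈ (far i) (sides-distinct i) resolving
      ... | inj₁ x∈Q = false , x∈Q
      ... | inj₂ y∈Q = true , y∈Q

      position : Fin t → Fin (length Q)
      position i = index (proj₂ (member i))

      position-injective : Injective _≡_ _≡_ position
      position-injective {i} {j} eq = cong proj₁ (e-inj (begin
        e (i , proj₁ (member i)) ≡⟨ lookup-index (proj₂ (member i)) ⟩
        lookup Q (position i)    ≡⟨ cong (lookup Q) eq ⟩
        lookup Q (position j)    ≡⟨ lookup-index (proj₂ (member j)) ⟨
        e (j , proj₁ (member j)) ∎))
        where open ≡-Reasoning

_×ᴰ_ : GraphDistance G → GraphDistance H → GraphDistance (G □ H)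
_×ᴰ_ {G} {H} DG DH = record
  { dist      = λ { (g , h) (g' , h') → DG.dist g g' + DH.dist h h' }
  ; dist-adj  = dist-adj
  ; geodesic  = λ { (g , h) (g' , h') →
      mapʷ (_, h) (λ e → inj₁ (refl , e)) (DG.geodesic g g') ++ʷ
      mapʷ (g' ,_) (λ e → inj₂ (refl , e)) (DH.geodesic h h') }
  ; dist≡0⇒≡ = λ {(g , h)} {(g' , h')} eq →
      cong₂ _,_ (DG.dist≡0⇒≡ (m+n≡0⇒m≡0 _ eq)) (DH.dist≡0⇒≡ (m+n≡0⇒n≡0 _ eq))
  ; dist-refl = λ { (g , h) → cong₂ _+_ (DG.dist-refl g) (DH.dist-refl h) }
  }
  where
    module DG = GraphDistance DG
    module DH = GraphDistance DH
    dist-adj : ∀ {u w} v → Adj (G □ H) u w →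
               DG.dist (proj₁ u) (proj₁ v) + DH.dist (proj₂ u) (proj₂ v)
               ≤ suc (DG.dist (proj₁ w) (proj₁ v) + DH.dist (proj₂ w) (proj₂ v))
    dist-adj {g , h} (g' , h') (inj₁ (refl , e)) = +-monoˡ-≤ (DH.dist h h') (DG.dist-adj g' e)
    dist-adj {g , h} (g' , h') (inj₂ (refl , e)) =
      ≤-trans (+-monoʳ-≤ (DG.dist g g') (DH.dist-adj h' e)) (≤-reflexive (+-suc _ _))

module _ {DG : GraphDistance G} {DH : GraphDistance H} where
  private
    module DG = GraphDistance DG
    module DH = GraphDistance DH

  farthest-× : ∀ {g g' h h'} → Farthest DG g g' → Farthest DH h h' →
               Farthest (DG ×ᴰ DH) (g , h) (g' , h')
  farthest-× (farthest g-far) (farthest h-far) = farthest λ (x , y) → +-mono-≤ (g-far x) (h-far y)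

  mutuallyFarthest-× : ∀ {g g' h h'} → MutuallyFarthest DG g g' → MutuallyFarthest DH h h' →
                       MutuallyFarthest (DG ×ᴰ DH) (g , h) (g' , h')
  mutuallyFarthest-× (g-far , g'-far) (h-far , h'-far) =
    farthest-× g-far h-far , farthest-× g'-far h'-far

  between-× : ∀ {q p r q' p' r'} → Between DG q p r → Between DH q' p' r' →
              Between (DG ×ᴰ DH) (q , q') (p , p') (r , r')
  between-× {q} {p} {r} {q'} {p'} {r'} (between g-btw) (between h-btw) = between (
    trans (interchange (DG.dist q p) (DH.dist q' p') (DG.dist p r) (DH.dist p' r'))
          (cong₂ _+_ g-btw h-btw))

-- Paths

∣n-1+n∣≡1 : ∀ n → ∣ n - suc n ∣ ≡ 1
∣n-1+n∣≡1 zero    = refl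
∣n-1+n∣≡1 (suc n) = ∣n-1+n∣≡1 n

∣-∣-lipschitz : ∀ {a b} x → ∣ a - b ∣ ≡ 1 → ∣ a - x ∣ ≤ suc ∣ b - x ∣
∣-∣-lipschitz {a} {b} x ∣a-b∣≡1 =
  ≤-trans (∣-∣-triangle a b x) (≤-reflexive (cong (_+ ∣ b - x ∣) ∣a-b∣≡1))

∣-∣-between : ∀ {a b c} → a ≤ b → b ≤ c → ∣ a - b ∣ + ∣ b - c ∣ ≡ ∣ a - c ∣
∣-∣-between {a} {b} {c} a≤b b≤c
  rewrite m≤n⇒∣m-n∣≡n∸m a≤b | m≤n⇒∣m-n∣≡n∸m b≤c | m≤n⇒∣m-n∣≡n∸m (≤-trans a≤b b≤c) =
  +-cancelˡ-≡ a _ _ (begin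
    a + ((b ∸ a) + (c ∸ b)) ≡⟨ +-assoc a (b ∸ a) (c ∸ b) ⟨
    a + (b ∸ a) + (c ∸ b)   ≡⟨ cong (_+ (c ∸ b)) (m+[n∸m]≡n a≤b) ⟩
    b + (c ∸ b)             ≡⟨ m+[n∸m]≡n b≤c ⟩
    c                       ≡⟨ m+[n∸m]≡n (≤-trans a≤b b≤c) ⟨
    a + (c ∸ a)             ∎)
  where open ≡-Reasoning

∣-∣-between′ : ∀ {a b c} → c ≤ b → b ≤ a → ∣ a - b ∣ + ∣ b - c ∣ ≡ ∣ a - c ∣
∣-∣-between′ {a} {b} {c} c≤b b≤a = begin
  ∣ a - b ∣ + ∣ b - c ∣ ≡⟨ cong₂ _+_ (∣-∣-comm a b) (∣-∣-comm b c) ⟩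
  ∣ b - a ∣ + ∣ c - b ∣ ≡⟨ +-comm ∣ b - a ∣ ∣ c - b ∣ ⟩
  ∣ c - b ∣ + ∣ b - a ∣ ≡⟨ ∣-∣-between c≤b b≤a ⟩
  ∣ c - a ∣             ≡⟨ ∣-∣-comm c a ⟩
  ∣ a - c ∣             ∎
  where open ≡-Reasoning

module _ {k : ℕ} where

  pathAdj-sym : Symmetric (Adj (PathG k))
  pathAdj-sym (inj₁ e) = inj₂ e
  pathAdj-sym (inj₂ e) = inj₁ e

  pathAdj⇒∣-∣≡1 : ∀ {u w} → Adj (PathG k) u w → ∣ toℕ u - toℕ w ∣ ≡ 1
  pathAdj⇒∣-∣≡1 {u}     (inj₁ w≡1+u) rewrite w≡1+u = ∣n-1+n∣≡1 (toℕ u)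
  pathAdj⇒∣-∣≡1 {w = w} (inj₂ u≡1+w) rewrite u≡1+w =
    trans (∣-∣-comm (suc (toℕ w)) (toℕ w)) (∣n-1+n∣≡1 (toℕ w))

  ascending : ∀ d {i j : Fin k} → toℕ j ≡ toℕ i + d → Walk (PathG k) i j d
  ascending zero    {i} {j} j≡i+0 =
    subst (λ x → Walk (PathG k) i x 0) (toℕ-injective (trans (sym (+-identityʳ _)) (sym j≡i+0))) []
  ascending (suc d) {i} {j} j≡i+1+d = inj₁ (toℕ-fromℕ< i+1<k) ∷ ascending d (begin
      toℕ j               ≡⟨ j≡i+1+d ⟩
      toℕ i + suc d       ≡⟨ +-suc (toℕ i) d ⟩
      suc (toℕ i) + d     ≡⟨ cong (_+ d) (toℕ-fromℕ< i+1<k) ⟨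
      toℕ (fromℕ< i+1<k) + d ∎)
    where
      open ≡-Reasoning
      i+1<k : suc (toℕ i) < k
      i+1<k = ≤-<-trans (subst (toℕ i <_) (sym j≡i+1+d) (m<m+n (toℕ i) z<s)) (toℕ<n j)

  pathGeodesic≤ : ∀ {i j : Fin k} → toℕ i ≤ toℕ j → Walk (PathG k) i j ∣ toℕ i - toℕ j ∣
  pathGeodesic≤ i≤j = castʷ (sym (m≤n⇒∣m-n∣≡n∸m i≤j)) (ascending _ (sym (m+[n∸m]≡n i≤j)))

pathDistance : ∀ k → GraphDistance (PathG k)
pathDistance k = record
  { dist      = λ i j → ∣ toℕ i - toℕ j ∣
  ; dist-adj  = λ {u} {w} v e → ∣-∣-lipschitz {toℕ u} {toℕ w} (toℕ v) (pathAdj⇒∣-∣≡1 e)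
  ; geodesic  = geodesic
  ; dist≡0⇒≡ = toℕ-injective ∘ ∣m-n∣≡0⇒m≡n
  ; dist-refl = ∣n-n∣≡0 ∘ toℕ
  }
  where
    geodesic : ∀ i j → Walk (PathG k) i j ∣ toℕ i - toℕ j ∣
    geodesic i j with ≤-total (toℕ i) (toℕ j)
    ... | inj₁ i≤j = pathGeodesic≤ i≤j
    ... | inj₂ j≤i =
      castʷ (∣-∣-comm (toℕ j) (toℕ i)) (reverseʷ pathAdj-sym (pathGeodesic≤ j≤i))

module _ {k : ℕ} where
  private
    D = pathDistance (suc k)

  end : Fin 2 → Fin (suc k)
  end zero       = zero
  end (suc zero) = fromℕ k

  end-mutuallyFarthest : ∀ s → MutuallyFarthest D (end s) (end (opposite s))
  end-mutuallyFarthest zero       = zero-farthest , fromℕ-farthest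
    where
      zero-farthest : Farthest D zero (fromℕ k)
      zero-farthest = farthest ≤fromℕ

      fromℕ-farthest : Farthest D (fromℕ k) zero
      fromℕ-farthest = farthest λ r → begin
        ∣ toℕ (fromℕ k) - toℕ r ∣ ≡⟨ m≤n⇒∣n-m∣≡n∸m (≤fromℕ r) ⟩
        toℕ (fromℕ k) ∸ toℕ r     ≤⟨ m∸n≤m _ (toℕ r) ⟩
        toℕ (fromℕ k)             ≡⟨ ∣-∣-identityʳ _ ⟨
        ∣ toℕ (fromℕ k) - 0 ∣     ∎
        where open ≤-Reasoning
  end-mutuallyFarthest (suc zero) = swap (end-mutuallyFarthest zero)

  between-zero : ∀ {q p} → toℕ p ≤ toℕ q → Between D q p zero
  between-zero p≤q = between (∣-∣-between′ z≤n p≤q)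

  between-fromℕ : ∀ {q p} → toℕ q ≤ toℕ p → Between D q p (fromℕ k)
  between-fromℕ {p = p} q≤p = between (∣-∣-between q≤p (≤fromℕ p))

  between-end : ∀ q p → ∃ λ s → Between D q p (end s)
  between-end q p with ≤-total (toℕ p) (toℕ q)
  ... | inj₁ p≤q = zero , between-zero p≤q
  ... | inj₂ q≤p = suc zero , between-fromℕ q≤p

end-injective : ∀ {k} → Injective _≡_ _≡_ (end {suc k})
end-injective {x = zero}     {zero}     _  = refl
end-injective {x = suc zero} {suc zero} _  = refl
end-injective {x = zero}     {suc zero} ()
end-injective {x = suc zero} {zero}     ()

-- Cycles

-- On a cycle of length N, two vertices at index distance δ are joined by
-- arcs of lengths δ and N ∸ δ.
shorterArc : ℕ → ℕ → ℕ
shorterArc N δ = δ ⊓ (N ∸ δ)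

module _ (N : ℕ) where

  shorterArc-lipschitz : ∀ {δ δ'} → δ ≤ suc δ' → δ' ≤ suc δ →
                         shorterArc N δ ≤ suc (shorterArc N δ')
  shorterArc-lipschitz {δ} {δ'} δ≤1+δ' δ'≤1+δ =
    ⊓-glb (m≤n⇒m⊓o≤n (N ∸ δ) δ≤1+δ') (m≤n⇒o⊓m≤n δ (m≤n+o⇒m∸n≤o N δ (begin
      N                 ≤⟨ m≤n+m∸n N δ' ⟩
      δ' + (N ∸ δ')     ≤⟨ +-monoˡ-≤ (N ∸ δ') δ'≤1+δ ⟩
      suc δ + (N ∸ δ')  ≡⟨ +-suc δ (N ∸ δ') ⟨
      δ + suc (N ∸ δ')  ∎)))
    where open ≤-Reasoning

  shorterArc-reflect : ∀ {δ} → δ ≤ N → shorterArc N (N ∸ δ) ≡ shorterArc N δ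
  shorterArc-reflect {δ} δ≤N rewrite m∸[m∸n]≡n δ≤N = ⊓-comm (N ∸ δ) δ

  shorterArc≡0⇒≡0 : ∀ {δ} → δ < N → shorterArc N δ ≡ 0 → δ ≡ 0
  shorterArc≡0⇒≡0 {δ} δ<N arc≡0 with ⊓-sel δ (N ∸ δ)
  ... | inj₁ arc≡δ   = trans (sym arc≡δ) arc≡0
  ... | inj₂ arc≡N∸δ = ⊥-elim (<⇒≱ δ<N (m∸n≡0⇒m≤n (trans (sym arc≡N∸δ) arc≡0)))

  shorterArc≤⌊N/2⌋ : ∀ δ → shorterArc N δ ≤ ⌊ N /2⌋
  shorterArc≤⌊N/2⌋ δ with δ ≤? ⌊ N /2⌋
  ... | yes δ≤⌊N/2⌋ = m≤n⇒m⊓o≤n (N ∸ δ) δ≤⌊N/2⌋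
  ... | no  δ≰⌊N/2⌋ = m≤n⇒o⊓m≤n δ (m≤n+o⇒m∸n≤o N δ (begin
      N                   ≡⟨ ⌊n/2⌋+⌈n/2⌉≡n N ⟨
      ⌊ N /2⌋ + ⌈ N /2⌉   ≡⟨ +-comm ⌊ N /2⌋ ⌈ N /2⌉ ⟩
      ⌈ N /2⌉ + ⌊ N /2⌋   ≤⟨ +-monoˡ-≤ ⌊ N /2⌋ (⌊n/2⌋-mono (n≤1+n (suc N))) ⟩
      suc ⌊ N /2⌋ + ⌊ N /2⌋ ≤⟨ +-monoˡ-≤ ⌊ N /2⌋ (≰⇒> δ≰⌊N/2⌋) ⟩
      δ + ⌊ N /2⌋         ∎))
    where open ≤-Reasoning

  N∸⌊N/2⌋≡⌈N/2⌉ : N ∸ ⌊ N /2⌋ ≡ ⌈ N /2⌉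
  N∸⌊N/2⌋≡⌈N/2⌉ = trans (cong (_∸ ⌊ N /2⌋) (sym (⌊n/2⌋+⌈n/2⌉≡n N))) (m+n∸m≡n ⌊ N /2⌋ ⌈ N /2⌉)

  N∸⌈N/2⌉≡⌊N/2⌋ : N ∸ ⌈ N /2⌉ ≡ ⌊ N /2⌋
  N∸⌈N/2⌉≡⌊N/2⌋ = trans (cong (_∸ ⌈ N /2⌉) (sym (⌊n/2⌋+⌈n/2⌉≡n N))) (m+n∸n≡m ⌊ N /2⌋ ⌈ N /2⌉)

  shorterArc-⌊N/2⌋ : shorterArc N ⌊ N /2⌋ ≡ ⌊ N /2⌋
  shorterArc-⌊N/2⌋ rewrite N∸⌊N/2⌋≡⌈N/2⌉ = m≤n⇒m⊓n≡m (⌊n/2⌋≤⌈n/2⌉ N)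

  shorterArc-⌈N/2⌉ : shorterArc N ⌈ N /2⌉ ≡ ⌊ N /2⌋
  shorterArc-⌈N/2⌉ = begin
    shorterArc N ⌈ N /2⌉           ≡⟨ cong (shorterArc N) N∸⌊N/2⌋≡⌈N/2⌉ ⟨
    shorterArc N (N ∸ ⌊ N /2⌋)     ≡⟨ shorterArc-reflect (⌊n/2⌋≤n N) ⟩
    shorterArc N ⌊ N /2⌋           ≡⟨ shorterArc-⌊N/2⌋ ⟩
    ⌊ N /2⌋                        ∎
    where open ≡-Reasoning

wrap-length : ∀ {i j n} → i ≤ j → j ≤ n → (n ∸ j) + suc i ≡ suc n ∸ (j ∸ i)
wrap-length {i} {j} {n} i≤j j≤n = sym (begin
  suc n ∸ (j ∸ i)                         ≡⟨ cong (_∸ (j ∸ i)) total ⟨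
  (n ∸ j) + suc i + (j ∸ i) ∸ (j ∸ i)     ≡⟨ m+n∸n≡m _ (j ∸ i) ⟩
  (n ∸ j) + suc i                         ∎)
  where
    open ≡-Reasoning
    total : (n ∸ j) + suc i + (j ∸ i) ≡ suc n
    total = begin
      (n ∸ j) + suc i + (j ∸ i)     ≡⟨ cong (_+ (j ∸ i)) (+-suc (n ∸ j) i) ⟩
      suc ((n ∸ j) + i + (j ∸ i))   ≡⟨ cong suc (+-assoc (n ∸ j) i (j ∸ i)) ⟩
      suc ((n ∸ j) + (i + (j ∸ i))) ≡⟨ cong (λ x → suc ((n ∸ j) + x)) (m+[n∸m]≡n i≤j) ⟩
      suc ((n ∸ j) + j)             ≡⟨ cong suc (m∸n+n≡m j≤n) ⟩
      suc n                         ∎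

module _ {n : ℕ} where
  private
    N = suc n
    C = Cycle N

  cycleAdj-sym : Symmetric (Adj C)
  cycleAdj-sym (inj₁ e)                = inj₂ (inj₁ e)
  cycleAdj-sym (inj₂ (inj₁ e))         = inj₁ e
  cycleAdj-sym (inj₂ (inj₂ (inj₁ e)))  = inj₂ (inj₂ (inj₂ e))
  cycleAdj-sym (inj₂ (inj₂ (inj₂ e)))  = inj₂ (inj₂ (inj₁ e))

  pathAdj⇒cycleAdj : ∀ {i j} → Adj (PathG N) i j → Adj C i j
  pathAdj⇒cycleAdj (inj₁ e) = inj₁ e
  pathAdj⇒cycleAdj (inj₂ e) = inj₂ (inj₁ e)

  wrapAdj : Adj C (fromℕ n) zero
  wrapAdj = inj₂ (inj₂ (inj₂ (refl , cong suc (toℕ-fromℕ n))))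

  cycleDist : Fin N → Fin N → ℕ
  cycleDist i j = shorterArc N ∣ toℕ i - toℕ j ∣

  cycleDist-comm : ∀ i j → cycleDist i j ≡ cycleDist j i
  cycleDist-comm i j = cong (shorterArc N) (∣-∣-comm (toℕ i) (toℕ j))

  -- Seen from the last vertex, index distances are shifted by one through the wrap edge.
  shorterArc-from-last : ∀ {x} → x ≤ n → shorterArc N ∣ n - x ∣ ≡ shorterArc N (suc x)
  shorterArc-from-last x≤n rewrite m≤n⇒∣n-m∣≡n∸m x≤n = shorterArc-reflect N (s≤s x≤n)

  pathAdj⇒cycleDist-adj : ∀ {u w} v → Adj (PathG N) u w → cycleDist u v ≤ suc (cycleDist w v)
  pathAdj⇒cycleDist-adj {u} {w} v e = shorterArc-lipschitz N
    (∣-∣-lipschitz {toℕ u} {toℕ w} (toℕ v) (pathAdj⇒∣-∣≡1 e))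
    (∣-∣-lipschitz {toℕ w} {toℕ u} (toℕ v) (pathAdj⇒∣-∣≡1 (pathAdj-sym e)))

  cycleDist-adj : ∀ {u w} v → Adj C u w → cycleDist u v ≤ suc (cycleDist w v)
  cycleDist-adj v (inj₁ e)        = pathAdj⇒cycleDist-adj v (inj₁ e)
  cycleDist-adj v (inj₂ (inj₁ e)) = pathAdj⇒cycleDist-adj v (inj₂ e)
  cycleDist-adj v (inj₂ (inj₂ (inj₁ (u≡0 , 1+w≡N))))
    rewrite u≡0 | suc-injective 1+w≡N | shorterArc-from-last (s≤s⁻¹ (toℕ<n v)) =
    shorterArc-lipschitz N (m≤n⇒m≤1+n (n≤1+n (toℕ v))) ≤-refl
  cycleDist-adj v (inj₂ (inj₂ (inj₂ (w≡0 , 1+u≡N))))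
    rewrite w≡0 | suc-injective 1+u≡N | shorterArc-from-last (s≤s⁻¹ (toℕ<n v)) =
    shorterArc-lipschitz N ≤-refl (m≤n⇒m≤1+n (n≤1+n (toℕ v)))

  pathWalk⇒cycleWalk : ∀ {i j ℓ} → Walk (PathG N) i j ℓ → Walk C i j ℓ
  pathWalk⇒cycleWalk = mapʷ id pathAdj⇒cycleAdj

  wrapWalk : ∀ i j → Walk C i j ((n ∸ toℕ j) + suc (toℕ i))
  wrapWalk i j = reverseʷ cycleAdj-sym
    (pathWalk⇒cycleWalk (ascending (n ∸ toℕ j) j→last) ++ʷ
     wrapAdj ∷ pathWalk⇒cycleWalk (ascending (toℕ i) refl))
    where
      j→last : toℕ (fromℕ n) ≡ toℕ j + (n ∸ toℕ j)
      j→last = trans (toℕ-fromℕ n) (sym (m+[n∸m]≡n (s≤s⁻¹ (toℕ<n j))))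

  cycleGeodesic≤ : ∀ {i j} → toℕ i ≤ toℕ j → Walk C i j (cycleDist i j)
  cycleGeodesic≤ {i} {j} i≤j with ≤-total ∣ toℕ i - toℕ j ∣ (N ∸ ∣ toℕ i - toℕ j ∣)
  ... | inj₁ δ≤N∸δ =
    castʷ (sym (m≤n⇒m⊓n≡m δ≤N∸δ)) (pathWalk⇒cycleWalk (pathGeodesic≤ i≤j))
  ... | inj₂ N∸δ≤δ = castʷ (begin
    (n ∸ toℕ j) + suc (toℕ i)           ≡⟨ wrap-length i≤j (s≤s⁻¹ (toℕ<n j)) ⟩
    N ∸ (toℕ j ∸ toℕ i)                 ≡⟨ cong (N ∸_) (m≤n⇒∣m-n∣≡n∸m i≤j) ⟨
    N ∸ ∣ toℕ i - toℕ j ∣               ≡⟨ m≥n⇒m⊓n≡n N∸δ≤δ ⟨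
    cycleDist i j                       ∎) (wrapWalk i j)
    where open ≡-Reasoning

  cycleGeodesic : ∀ i j → Walk C i j (cycleDist i j)
  cycleGeodesic i j with ≤-total (toℕ i) (toℕ j)
  ... | inj₁ i≤j = cycleGeodesic≤ i≤j
  ... | inj₂ j≤i = castʷ (cycleDist-comm j i) (reverseʷ cycleAdj-sym (cycleGeodesic≤ j≤i))

  ∣toℕ-toℕ∣<N : ∀ (i j : Fin N) → ∣ toℕ i - toℕ j ∣ < N
  ∣toℕ-toℕ∣<N i j = s≤s (≤-trans (∣m-n∣≤m⊔n (toℕ i) (toℕ j))
                                 (⊔-lub (s≤s⁻¹ (toℕ<n i)) (s≤s⁻¹ (toℕ<n j))))

cycleDistance : ∀ n → GraphDistance (Cycle (suc n))
cycleDistance n = record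
  { dist      = cycleDist
  ; dist-adj  = cycleDist-adj
  ; geodesic  = cycleGeodesic
  ; dist≡0⇒≡ = λ {i} {j} d≡0 →
      toℕ-injective (∣m-n∣≡0⇒m≡n (shorterArc≡0⇒≡0 (suc n) (∣toℕ-toℕ∣<N i j) d≡0))
  ; dist-refl = λ i → cong (shorterArc (suc n)) (∣n-n∣≡0 (toℕ i))
  }

module _ {n : ℕ} where
  private
    N = suc n

  -- Rotation of the cycle by ⌊N/2⌋ steps.
  antipodeℕ : ℕ → ℕ
  antipodeℕ x with x <? ⌈ N /2⌉
  ... | yes _ = x + ⌊ N /2⌋
  ... | no  _ = x ∸ ⌈ N /2⌉

  antipodeℕ<N : ∀ {x} → x < N → antipodeℕ x < N
  antipodeℕ<N {x} x<N with x <? ⌈ N /2⌉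
  ... | yes x<⌈N/2⌉ = begin-strict
    x + ⌊ N /2⌋         <⟨ +-monoˡ-< ⌊ N /2⌋ x<⌈N/2⌉ ⟩
    ⌈ N /2⌉ + ⌊ N /2⌋   ≡⟨ +-comm ⌈ N /2⌉ ⌊ N /2⌋ ⟩
    ⌊ N /2⌋ + ⌈ N /2⌉   ≡⟨ ⌊n/2⌋+⌈n/2⌉≡n N ⟩
    N                   ∎
    where open ≤-Reasoning
  ... | no _ = ≤-<-trans (m∸n≤m x ⌈ N /2⌉) x<N

  shorterArc-antipodeℕ : ∀ x → shorterArc N ∣ x - antipodeℕ x ∣ ≡ ⌊ N /2⌋
  shorterArc-antipodeℕ x with x <? ⌈ N /2⌉
  ... | yes _ = trans (cong (shorterArc N) (∣m-m+n∣≡n x ⌊ N /2⌋)) (shorterArc-⌊N/2⌋ N)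
  ... | no x≮⌈N/2⌉ = trans (cong (shorterArc N) ∣x-[x∸⌈N/2⌉]∣≡⌈N/2⌉) (shorterArc-⌈N/2⌉ N)
    where
      ∣x-[x∸⌈N/2⌉]∣≡⌈N/2⌉ : ∣ x - x ∸ ⌈ N /2⌉ ∣ ≡ ⌈ N /2⌉
      ∣x-[x∸⌈N/2⌉]∣≡⌈N/2⌉ =
        trans (m≤n⇒∣n-m∣≡n∸m (m∸n≤m x ⌈ N /2⌉)) (m∸[m∸n]≡n (≮⇒≥ x≮⌈N/2⌉))

  ∸⌈N/2⌉<⌊N/2⌋ : ∀ {z} → z < N → z ≮ ⌈ N /2⌉ → z ∸ ⌈ N /2⌉ < ⌊ N /2⌋
  ∸⌈N/2⌉<⌊N/2⌋ {z} z<N z≮⌈N/2⌉ =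
    subst (z ∸ ⌈ N /2⌉ <_) (N∸⌈N/2⌉≡⌊N/2⌋ N) (∸-monoˡ-< z<N (≮⇒≥ z≮⌈N/2⌉))

  -- The two branches of antipodeℕ take values ≥ ⌊N/2⌋ and < ⌊N/2⌋ respectively.
  antipodeℕ-injective : ∀ {x y} → x < N → y < N → antipodeℕ x ≡ antipodeℕ y → x ≡ y
  antipodeℕ-injective {x} {y} x<N y<N eq with x <? ⌈ N /2⌉ | y <? ⌈ N /2⌉
  ... | yes _        | yes _        = +-cancelʳ-≡ ⌊ N /2⌋ x y eq
  ... | no x≮⌈N/2⌉ | no y≮⌈N/2⌉ = ∸-cancelʳ-≡ (≮⇒≥ x≮⌈N/2⌉) (≮⇒≥ y≮⌈N/2⌉) eq
  ... | yes _        | no y≮⌈N/2⌉ =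
    ⊥-elim (<⇒≱ (∸⌈N/2⌉<⌊N/2⌋ y<N y≮⌈N/2⌉) (≤-trans (m≤n+m ⌊ N /2⌋ x) (≤-reflexive eq)))
  ... | no x≮⌈N/2⌉ | yes _        =
    ⊥-elim (<⇒≱ (∸⌈N/2⌉<⌊N/2⌋ x<N x≮⌈N/2⌉) (≤-trans (m≤n+m ⌊ N /2⌋ y) (≤-reflexive (sym eq))))

  antipode : Fin N → Fin N
  antipode a = fromℕ< (antipodeℕ<N (toℕ<n a))

  antipode-injective : Injective _≡_ _≡_ antipode
  antipode-injective {a} {b} eq = toℕ-injective (antipodeℕ-injective (toℕ<n a) (toℕ<n b) (begin
    antipodeℕ (toℕ a)  ≡⟨ toℕ-fromℕ< (antipodeℕ<N (toℕ<n a)) ⟨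
    toℕ (antipode a)   ≡⟨ cong toℕ eq ⟩
    toℕ (antipode b)   ≡⟨ toℕ-fromℕ< (antipodeℕ<N (toℕ<n b)) ⟩
    antipodeℕ (toℕ b)  ∎))
    where open ≡-Reasoning

  cycleDist-antipode : ∀ a → cycleDist a (antipode a) ≡ ⌊ N /2⌋
  cycleDist-antipode a rewrite toℕ-fromℕ< (antipodeℕ<N (toℕ<n a)) = shorterArc-antipodeℕ (toℕ a)

  antipode-mutuallyFarthest : ∀ a → MutuallyFarthest (cycleDistance n) a (antipode a)
  antipode-mutuallyFarthest a =
    farthest (λ r → subst (cycleDist a r ≤_) (sym (cycleDist-antipode a)) (shorterArc≤⌊N/2⌋ N _)) ,
    farthest (λ r → subst (cycleDist (antipode a) r ≤_) (sym back) (shorterArc≤⌊N/2⌋ N _))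
    where
      back : cycleDist (antipode a) a ≡ ⌊ N /2⌋
      back = trans (cycleDist-comm (antipode a) a) (cycleDist-antipode a)

-- The prism C_n □ P_k □ P_m

remQuot-injective : ∀ {m} k → Injective _≡_ _≡_ (remQuot {m} k)
remQuot-injective {m} k {i} {j} eq =
  trans (sym (combine-remQuot {m} k i)) (trans (cong (uncurry combine) eq) (combine-remQuot {m} k j))

opposite-injective : ∀ {m} → Injective _≡_ _≡_ (opposite {m})
opposite-injective {x = x} {y} eq =
  trans (sym (opposite-involutive x)) (trans (cong opposite eq) (opposite-involutive y))

module _ (n k m : ℕ) where
  private
    N = suc n
    Prism = (Cycle N □ PathG (suc (suc k))) □ PathG (suc (suc m))
    DC = cycleDistance n
    DK = pathDistance (suc (suc k))
    DM = pathDistance (suc (suc m))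
    DC×DK = DC ×ᴰ DK
    D = DC×DK ×ᴰ DM

  -- corner (s , a) is (a, 0, 0) or (a, 0, m−1) according to s, and farCorner (s , a)
  -- is (a + ⌊n/2⌋ mod n, k−1, m−1) or (a + ⌊n/2⌋ mod n, k−1, 0) respectively.
  corner : Fin 2 × Fin N → V Prism
  corner (s , a) = ((a , end zero) , end s)

  farCorner : Fin 2 × Fin N → V Prism
  farCorner (s , a) = ((antipode a , end (suc zero)) , end (opposite s))

  corner-injective : Injective _≡_ _≡_ corner
  corner-injective eq = cong₂ _,_ (end-injective (cong proj₂ eq)) (cong (proj₁ ∘ proj₁) eq)

  farCorner-injective : Injective _≡_ _≡_ farCorner
  farCorner-injective eq =
    cong₂ _,_ (opposite-injective (end-injective (cong proj₂ eq)))
              (antipode-injective (cong (proj₁ ∘ proj₁) eq))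

  corner-mutuallyFarthest : ∀ x → MutuallyFarthest D (corner x) (farCorner x)
  corner-mutuallyFarthest (s , a) = mutuallyFarthest-×
    (mutuallyFarthest-× (antipode-mutuallyFarthest a) (end-mutuallyFarthest zero))
    (end-mutuallyFarthest s)

  corners : List (V Prism)
  corners = map (corner ∘ remQuot N) (allFin (2 * N))

  corner∈corners : ∀ x → corner x ∈ corners
  corner∈corners (s , a) =
    subst (_∈ corners) (cong corner (remQuot-combine s a))
          (∈-map⁺ (corner ∘ remQuot N) (∈-allFin (combine s a)))

  corners-unique : Unique corners
  corners-unique = map⁺ (remQuot-injective {2} N ∘ corner-injective) (allFin⁺ (2 * N))

  length-corners : length corners ≡ 2 * N
  length-corners = trans (length-map (corner ∘ remQuot N) (allFin (2 * N))) (length-tabulate id)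

  corners-resolve : ∀ p q → toℕ (proj₂ (proj₁ p)) ≤ toℕ (proj₂ (proj₁ q)) →
                    ∃ λ r → r ∈ corners × OnShortest Prism p q r
  corners-resolve ((a , b) , c) ((a' , b') , c') b≤b' with between-end c' c
  ... | s , c'-c-end = corner (s , a) , corner∈corners (s , a) ,
    Between⇒OnShortest D
      (between-×
        (between-× (between-refl DC a' a) (between-zero b≤b')) c'-c-end)

  corners-strongResolving : StrongResolving Prism corners
  corners-strongResolving p q _ with ≤-total (toℕ (proj₂ (proj₁ p))) (toℕ (proj₂ (proj₁ q)))
  ... | inj₁ p≤q = let r , r∈Q , p-on = corners-resolve p q p≤q in r , r∈Q , inj₁ p-on
  ... | inj₂ q≤p = let r , r∈Q , q-on = corners-resolve q p q≤p in r , r∈Q , inj₂ q-on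

  antipodalPair : Fin (2 * N) × Bool → V Prism
  antipodalPair (i , false) = corner (remQuot N i)
  antipodalPair (i , true)  = farCorner (remQuot N i)

  antipodalPair-injective : Injective _≡_ _≡_ antipodalPair
  antipodalPair-injective {i , false} {j , false} eq =
    cong (_, false) (remQuot-injective {2} N (corner-injective eq))
  antipodalPair-injective {i , true}  {j , true}  eq =
    cong (_, true) (remQuot-injective {2} N (farCorner-injective eq))
  antipodalPair-injective {i , false} {j , true}  eq
    with end-injective {x = zero} {suc zero} (cong (proj₂ ∘ proj₁) eq)
  ... | ()
  antipodalPair-injective {i , true}  {j , false} eq
    with end-injective {x = suc zero} {zero} (cong (proj₂ ∘ proj₁) eq)
  ... | ()

  prism-sdim : SdimIs Prism (2 * N)
  prism-sdim =
    (corners , corners-unique , corners-strongResolving , length-corners) ,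
    λ Q _ resolving → mutuallyFarthestPairs⇒≤length D antipodalPair antipodalPair-injective
                        (corner-mutuallyFarthest ∘ remQuot N) resolving

theorem3p12 : (n k m : ℕ) → 3 ≤ n → 3 ≤ k → 2 ≤ m →
    SdimIs ((Cycle n □ PathG k) □ PathG m) (2 * n)
theorem3p12 (suc n) (suc (suc k)) (suc (suc m)) _ _ _ = prism-sdim n k m
theorem3p12 (suc _) (suc zero)    _            _ (s≤s ()) _
theorem3p12 (suc _) (suc (suc _)) (suc zero)   _ _ (s≤s ())
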